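{- There exists no doubly Eulerian graph of even order $n\geq 4$ containing a vertex of valency $n-2$.
   Context: All graphs are finite, simple and connected. An Eulerian circuit is a closed trail traversing every edge exactly once. Let $G$ be Eulerian with $m$ edges and $u$ a vertex. Two Eulerian circuits $u,v_1,\ldots,v_{m-1},u$ and $u,w_1,\ldots,w_{m-1},u$ are avoiding if for every $1\le i\le m-1$, $v_i\neq w_i$ and $v_i$ is not adjacent to $w_i$. $G$ is doubly Eulerian if it is Eulerian and for every vertex $u$ there is a pair of avoiding Eulerian circuits starting and ending at $u$. -}

module Defs where

open import Data.Nat using (ℕ; zero; suc; _≤_; _<_)
open import Data.Bool using (Bool; true; false; if_then_else_)
open import Data.Fin using (Fin; toℕ; inject₁; fromℕ) renaming (zero to fz; suc to fs)
open import Data.List using (List; map; allFin)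
open import Data.Nat.ListAction using (sum)
open import Data.Product using (Σ; _×_; ∃)
open import Data.Sum using (_⊎_)
open import Relation.Nullary using (¬_)
open import Relation.Binary.PropositionalEquality using (_≡_; _≢_)

record Graph (n : ℕ) : Set where
  field
    adj   : Fin n → Fin n → Bool
    sym   : ∀ x y → adj x y ≡ adj y x
    irrefl : ∀ x → adj x x ≡ false

open Graph public

Adj : ∀ {n} → Graph n → Fin n → Fin n → Set
Adj G x y = adj G x y ≡ true

degree : ∀ {n} → Graph n → Fin n → ℕ
degree {n} G v = sum (map (λ y → if adj G v y then 1 else 0) (allFin n))

IsWalk : ∀ {n} → Graph n → (k : ℕ) → (Fin (suc k) → Fin n) → Set
IsWalk G k w = ∀ (i : Fin k) → Adj G (w (inject₁ i)) (w (fs i))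

Connected : ∀ {n} → Graph n → Set
Connected {n} G = ∀ (x y : Fin n) →
  Σ ℕ λ k → Σ (Fin (suc k) → Fin n) λ w →
    IsWalk G k w × w fz ≡ x × w (fromℕ k) ≡ y

Traverses : ∀ {n k} → (Fin (suc k) → Fin n) → Fin k → Fin n → Fin n → Set
Traverses w i x y =
  (w (inject₁ i) ≡ x × w (fs i) ≡ y) ⊎ (w (inject₁ i) ≡ y × w (fs i) ≡ x)

IsEulerianCircuit : ∀ {n} → Graph n → Fin n → (k : ℕ) → (Fin (suc k) → Fin n) → Set
IsEulerianCircuit {n} G u k w =
  IsWalk G k w × w fz ≡ u × w (fromℕ k) ≡ u ×
  (∀ (x y : Fin n) → Adj G x y →
     Σ (Fin k) λ i → Traverses w i x y × (∀ (j : Fin k) → Traverses w j x y → j ≡ i))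

Eulerian : ∀ {n} → Graph n → Set
Eulerian {n} G = Connected G × Σ (Fin n) λ u → Σ ℕ λ k → Σ (Fin (suc k) → Fin n) λ w →
  IsEulerianCircuit G u k w

Avoiding : ∀ {n} → Graph n → (k : ℕ) → (Fin (suc k) → Fin n) → (Fin (suc k) → Fin n) → Set
Avoiding G k v w = ∀ (i : Fin (suc k)) → 1 ≤ toℕ i → toℕ i < k →
  v i ≢ w i × ¬ Adj G (v i) (w i)

DoublyEulerian : ∀ {n} → Graph n → Set
DoublyEulerian {n} G = Eulerian G × (∀ (u : Fin n) →
  Σ ℕ λ k → Σ (Fin (suc k) → Fin n) λ v → Σ (Fin (suc k) → Fin n) λ w →
    IsEulerianCircuit G u k v × IsEulerianCircuit G u k w × Avoiding G k v w)

-- Let x be the unique vertex other than v that is not adjacent to v, and take an avoiding pair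
-- c₁, c₂ of Eulerian circuits at x. Whenever c₁ is at v, c₂ is at a vertex that is neither v
-- nor a neighbour of v, that is, at x. So each of the n − 2 steps in which c₁ uses an edge vy
-- is a step in which c₂ uses an edge at x; together with the first and the last step of c₂
-- these are n distinct steps, hence c₂ uses n distinct edges at x. None of them goes to v, so
-- x would have n neighbours among the other n − 1 vertices.
module Submission where

open import Defs
open import Data.Nat using (ℕ; zero; suc; _≤_; _<_; _∸_; _+_; z≤n; s≤s)
open import Data.Nat.Properties using (≤-trans; ≤∧≢⇒<; <⇒≱; 1+n≰n; ∸-monoˡ-≤; m∸[m∸n]≡n)
open import Data.Nat.Divisibility using (_∣_)
open import Data.Nat.ListAction using (sum)
open import Data.Bool using (Bool; true; false; if_then_else_)
import Data.Bool.Properties as Bool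
open import Data.Fin using (Fin; toℕ; inject₁; fromℕ; punchOut; _≟_) renaming (zero to fz; suc to fs)
open import Data.Fin.Properties using (toℕ-injective; toℕ-fromℕ; toℕ<n; any?; injective⇒≤; punchOut-injective)
open import Data.Fin.Subset using (Subset; _∈_; _∉_; _⊆_; ∁; ⁅_⁆; ∣_∣; _-_) renaming (⊥ to ∅)
open import Data.Fin.Subset.Properties
  using (_∈?_; p⊆q⇒∣p∣≤∣q∣; ∣⁅x⁆∣≡1; ∣⊥∣≡0; x∈p⇒∣p-x∣<∣p∣; x∈p∧x≢y⇒x∈p-y; ∣∁p∣≡n∸∣p∣;
         x∈∁p⇒x∉p; x∉p⇒x∈∁p; x∉⁅y⁆⇒x≢y)
import Data.List as List
open import Data.List.Properties using (map-tabulate)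
import Data.Vec as Vec
open import Data.Vec.Properties using (lookup∘tabulate; []=⇒lookup; lookup⇒[]=)
open import Data.Product using (Σ; _×_; _,_; proj₁; proj₂; ∃; uncurry)
open import Data.Sum using (_⊎_; inj₁; inj₂)
open import Data.Empty using (⊥; ⊥-elim)
open import Function using (_∘_; id)
open import Function.Definitions using (Injective)
open import Relation.Nullary using (¬_; yes; no)
open import Relation.Nullary.Decidable using (_×-dec_; ¬?; decidable-stable)
open import Relation.Binary.PropositionalEquality using (_≡_; _≢_; refl; trans; cong; subst; subst₂)
import Relation.Binary.PropositionalEquality as ≡

∣q∣<∣p∣⇒∃-∈p-∉q : ∀ {n} {p q : Subset n} → ∣ q ∣ < ∣ p ∣ → ∃ λ y → y ∈ p × y ∉ q
∣q∣<∣p∣⇒∃-∈p-∉q {p = p} {q} ∣q∣<∣p∣ with any? (λ y → (y ∈? p) ×-dec ¬? (y ∈? q))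
... | yes witness = witness
... | no none     = ⊥-elim (<⇒≱ ∣q∣<∣p∣ (p⊆q⇒∣p∣≤∣q∣ p⊆q))
  where
  p⊆q : p ⊆ q
  p⊆q {y} y∈p = decidable-stable (y ∈? q) (λ y∉q → none (y , y∈p , y∉q))

x,y,z∈p⇒3≤∣p∣ : ∀ {n} {p : Subset n} {x y z} → x ≢ y → x ≢ z → y ≢ z →
                x ∈ p → y ∈ p → z ∈ p → 3 ≤ ∣ p ∣
x,y,z∈p⇒3≤∣p∣ x≢y x≢z y≢z x∈p y∈p z∈p =
  ≤-trans (s≤s (≤-trans (s≤s (≤-trans (s≤s z≤n) (x∈p⇒∣p-x∣<∣p∣ z∈p-x-y)))
                        (x∈p⇒∣p-x∣<∣p∣ y∈p-x)))
          (x∈p⇒∣p-x∣<∣p∣ x∈p)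
  where
  y∈p-x = x∈p∧x≢y⇒x∈p-y y∈p (x≢y ∘ ≡.sym)
  z∈p-x-y = x∈p∧x≢y⇒x∈p-y (x∈p∧x≢y⇒x∈p-y z∈p (x≢z ∘ ≡.sym)) (y≢z ∘ ≡.sym)

module _ {n : ℕ} (G : Graph n) where

  adj-sym : ∀ {x y} → Adj G x y → Adj G y x
  adj-sym {x} {y} x~y = trans (Graph.sym G y x) x~y

  adj-irrefl : ∀ x → ¬ Adj G x x
  adj-irrefl x x~x with () ← trans (≡.sym x~x) (irrefl G x)

  neighbours : Fin n → Subset n
  neighbours v = Vec.tabulate (adj G v)

  ∈-neighbours⁺ : ∀ {v y} → Adj G v y → y ∈ neighbours v
  ∈-neighbours⁺ {v} {y} v~y = lookup⇒[]= y (neighbours v) (trans (lookup∘tabulate (adj G v) y) v~y)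

  ∈-neighbours⁻ : ∀ {v y} → y ∈ neighbours v → Adj G v y
  ∈-neighbours⁻ {v} {y} y∈N = trans (≡.sym (lookup∘tabulate (adj G v) y)) ([]=⇒lookup y∈N)

sum-indicator≡∣tabulate∣ : ∀ {n} (b : Fin n → Bool) →
  sum (List.tabulate (λ y → if b y then 1 else 0)) ≡ ∣ Vec.tabulate b ∣
sum-indicator≡∣tabulate∣ {zero}  b = refl
sum-indicator≡∣tabulate∣ {suc n} b with b fz
... | true  = cong suc (sum-indicator≡∣tabulate∣ (b ∘ fs))
... | false = sum-indicator≡∣tabulate∣ (b ∘ fs)

degree≡∣neighbours∣ : ∀ {n} (G : Graph n) v → degree G v ≡ ∣ neighbours G v ∣
degree≡∣neighbours∣ G v =
  trans (cong sum (map-tabulate id (λ y → if adj G v y then 1 else 0)))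
        (sum-indicator≡∣tabulate∣ (adj G v))

has-neighbour : ∀ {n} (G : Graph n) {v} → 1 ≤ degree G v → ∃ (Adj G v)
has-neighbour {n} G {v} 1≤deg
  with y , y∈N , _ ← ∣q∣<∣p∣⇒∃-∈p-∉q {p = neighbours G v} {q = ∅}
                        (subst₂ _<_ (≡.sym (∣⊥∣≡0 n)) (degree≡∣neighbours∣ G v) 1≤deg)
  = y , ∈-neighbours⁻ G y∈N

-- The non-neighbours of v, v itself included, form the complement of its neighbourhood,
-- which has exactly two elements.
sole-non-neighbour : ∀ {n} (G : Graph n) v → 2 ≤ n → degree G v ≡ n ∸ 2 →
  ∃ λ x → x ≢ v × ¬ Adj G v x × (∀ z → z ≢ v → ¬ Adj G v z → z ≡ x)
sole-non-neighbour {n} G v 2≤n deg = x , x∉⁅y⁆⇒x≢y x∉⁅v⁆ , non-neighbour⁻ x∈C , only-x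
  where
  C = ∁ (neighbours G v)

  ∣C∣≡2 : ∣ C ∣ ≡ 2
  ∣C∣≡2 = begin
    ∣ C ∣                    ≡⟨ ∣∁p∣≡n∸∣p∣ (neighbours G v) ⟩
    n ∸ ∣ neighbours G v ∣   ≡⟨ cong (n ∸_) (degree≡∣neighbours∣ G v) ⟨
    n ∸ degree G v           ≡⟨ cong (n ∸_) deg ⟩
    n ∸ (n ∸ 2)              ≡⟨ m∸[m∸n]≡n 2≤n ⟩
    2                        ∎
    where open ≡.≡-Reasoning

  non-neighbour⁺ : ∀ {z} → ¬ Adj G v z → z ∈ C
  non-neighbour⁺ v≁z = x∉p⇒x∈∁p (v≁z ∘ ∈-neighbours⁻ G)

  non-neighbour⁻ : ∀ {z} → z ∈ C → ¬ Adj G v z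
  non-neighbour⁻ z∈C = x∈∁p⇒x∉p z∈C ∘ ∈-neighbours⁺ G

  outside-⁅v⁆ : ∃ λ x → x ∈ C × x ∉ ⁅ v ⁆
  outside-⁅v⁆ = ∣q∣<∣p∣⇒∃-∈p-∉q (subst₂ _<_ (≡.sym (∣⁅x⁆∣≡1 v)) (≡.sym ∣C∣≡2) (s≤s (s≤s z≤n)))

  x = proj₁ outside-⁅v⁆
  x∈C = proj₁ (proj₂ outside-⁅v⁆)
  x∉⁅v⁆ = proj₂ (proj₂ outside-⁅v⁆)

  only-x : ∀ z → z ≢ v → ¬ Adj G v z → z ≡ x
  only-x z z≢v v≁z = decidable-stable (z ≟ x) λ z≢x →
    1+n≰n (subst (3 ≤_) ∣C∣≡2
      (x,y,z∈p⇒3≤∣p∣ (x∉⁅y⁆⇒x≢y x∉⁅v⁆ ∘ ≡.sym) (z≢v ∘ ≡.sym) (z≢x ∘ ≡.sym)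
                     (non-neighbour⁺ (adj-irrefl G v)) x∈C (non-neighbour⁺ v≁z)))

injective⇒¬avoids : ∀ {n} {f : Fin n → Fin n} → Injective _≡_ _≡_ f → (v : Fin n) → ¬ (∀ y → f y ≢ v)
injective⇒¬avoids {suc m} {f} f-inj v f≢v = 1+n≰n (injective⇒≤ punchOut∘f-injective)
  where
  v≢f : ∀ y → v ≢ f y
  v≢f y = f≢v y ∘ ≡.sym

  punchOut∘f-injective : Injective _≡_ _≡_ (λ y → punchOut (v≢f y))
  punchOut∘f-injective {y} {y′} = f-inj ∘ punchOut-injective (v≢f y) (v≢f y′)

Touches : ∀ {n k} → (Fin (suc k) → Fin n) → Fin k → Fin n → Set
Touches w i x = w (inject₁ i) ≡ x ⊎ w (fs i) ≡ x

module _ {n k : ℕ} (w : Fin (suc k) → Fin n) where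

  touches⇒traverses : ∀ {i x} → Touches w i x → ∃ (Traverses w i x)
  touches⇒traverses (inj₁ p) = _ , inj₁ (p , refl)
  touches⇒traverses (inj₂ p) = _ , inj₂ (refl , p)

  traverses-source : ∀ {i x y} → Traverses w i x y → w (inject₁ i) ≡ x ⊎ w (inject₁ i) ≡ y
  traverses-source (inj₁ (p , _)) = inj₁ p
  traverses-source (inj₂ (p , _)) = inj₂ p

  traverses-target : ∀ {i x y} → Traverses w i x y → w (fs i) ≡ x ⊎ w (fs i) ≡ y
  traverses-target (inj₁ (_ , q)) = inj₂ q
  traverses-target (inj₂ (_ , q)) = inj₁ q

  traverses-functional : ∀ {i x y y′} → Traverses w i x y → Traverses w i x y′ → y ≢ x → y ≡ y′
  traverses-functional (inj₁ (_ , q)) (inj₁ (_ , q′)) _   = trans (≡.sym q) q′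
  traverses-functional (inj₁ (_ , q)) (inj₂ (_ , q′)) y≢x = ⊥-elim (y≢x (trans (≡.sym q) q′))
  traverses-functional (inj₂ (p , _)) (inj₁ (p′ , _)) y≢x = ⊥-elim (y≢x (trans (≡.sym p) p′))
  traverses-functional (inj₂ (p , _)) (inj₂ (p′ , _)) _   = trans (≡.sym p) p′

  interior : ∀ {u} t → w fz ≡ u → w (fromℕ k) ≡ u → w t ≢ u → 1 ≤ toℕ t × toℕ t < k
  interior fz     start _   wt≢u = ⊥-elim (wt≢u start)
  interior (fs t) _     end wt≢u = s≤s z≤n , ≤∧≢⇒< (toℕ<n t) t≢last
    where
    t≢last : suc (toℕ t) ≢ k
    t≢last e = wt≢u (trans (cong w (toℕ-injective (trans e (≡.sym (toℕ-fromℕ k))))) end)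

  module _ (G : Graph n) where

    traverses⇒adj : IsWalk G k w → ∀ {i x y} → Traverses w i x y → Adj G x y
    traverses⇒adj walk {i} (inj₁ (refl , refl)) = walk i
    traverses⇒adj walk {i} (inj₂ (refl , refl)) = adj-sym G (walk i)

    circuit-traverses-once : ∀ {u i j x y} → IsEulerianCircuit G u k w →
      Traverses w i x y → Traverses w j x y → i ≡ j
    circuit-traverses-once (walk , _ , _ , once) tᵢ tⱼ
      with _ , _ , unique ← once _ _ (traverses⇒adj walk tᵢ)
      = trans (unique _ tᵢ) (≡.sym (unique _ tⱼ))

circuit-length≥2 : ∀ {n} (G : Graph n) {u k} (w : Fin (suc k) → Fin n) {x y} →
  IsEulerianCircuit G u k w → Adj G x y → 2 ≤ k
circuit-length≥2 G {k = zero} w (_ , _ , _ , once) x~y with () , _ ← once _ _ x~y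
circuit-length≥2 G {u} {suc zero} w (walk , start , end , _) _ =
  ⊥-elim (adj-irrefl G u (subst₂ (Adj G) start end (walk fz)))
circuit-length≥2 _ {k = suc (suc k)} _ _ _ = s≤s (s≤s z≤n)

module _ {n} (G : Graph n) {v x : Fin n}
         (x≢v : x ≢ v) (v≁x : ¬ Adj G v x) (only-x : ∀ z → z ≢ v → ¬ Adj G v z → z ≡ x)
         {k} {c₁ c₂ : Fin (3 + k) → Fin n}
         (E₁ : IsEulerianCircuit G x (2 + k) c₁) (E₂ : IsEulerianCircuit G x (2 + k) c₂)
         (avoiding : Avoiding G (2 + k) c₁ c₂) where

  private
    first last : Fin (2 + k)
    first = fz
    last  = fromℕ (suc k)

    c₁-starts : c₁ fz ≡ x
    c₁-starts = proj₁ (proj₂ E₁)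

    c₁-ends : c₁ (fromℕ (2 + k)) ≡ x
    c₁-ends = proj₁ (proj₂ (proj₂ E₁))

    partner : ∀ t → c₁ t ≡ v → c₂ t ≡ x
    partner t c₁t≡v = only-x (c₂ t) (proj₁ avoids-at-t ∘ trans c₁t≡v ∘ ≡.sym)
                                    (proj₂ avoids-at-t ∘ subst (λ a → Adj G a (c₂ t)) (≡.sym c₁t≡v))
      where
      c₁t≢x : c₁ t ≢ x
      c₁t≢x c₁t≡x = x≢v (trans (≡.sym c₁t≡x) c₁t≡v)

      avoids-at-t : c₁ t ≢ c₂ t × ¬ Adj G (c₁ t) (c₂ t)
      avoids-at-t = uncurry (avoiding t) (interior c₁ t c₁-starts c₁-ends c₁t≢x)

    spoke-touches : ∀ {j y} → Traverses c₁ j v y → Touches c₂ j x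
    spoke-touches (inj₁ (p , _)) = inj₁ (partner _ p)
    spoke-touches (inj₂ (_ , p)) = inj₂ (partner _ p)

    spoke-not-first : ∀ {y} → y ≢ x → ¬ Traverses c₁ first v y
    spoke-not-first y≢x t with traverses-source c₁ t
    ... | inj₁ c₁0≡v = x≢v (trans (≡.sym c₁-starts) c₁0≡v)
    ... | inj₂ c₁0≡y = y≢x (trans (≡.sym c₁0≡y) c₁-starts)

    spoke-not-last : ∀ {y} → y ≢ x → ¬ Traverses c₁ last v y
    spoke-not-last y≢x t with traverses-target c₁ t
    ... | inj₁ c₁K≡v = x≢v (trans (≡.sym c₁-ends) c₁K≡v)
    ... | inj₂ c₁K≡y = y≢x (trans (≡.sym c₁K≡y) c₁-ends)

    adjacent-to-v : ∀ {y} → y ≢ v → y ≢ x → Adj G v y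
    adjacent-to-v {y} y≢v y≢x = decidable-stable (adj G v y Bool.≟ true) (y≢x ∘ only-x y y≢v)

    -- Slot y j: step j of c₂ is the step charged to the vertex y; start and finish cannot
    -- share a step because the length is at least 2.
    data Slot : Fin n → Fin (2 + k) → Set where
      start  : Slot v first
      finish : Slot x last
      spoke  : ∀ {y j} → y ≢ v → y ≢ x → Traverses c₁ j v y → Slot y j

    slot : ∀ y → ∃ (Slot y)
    slot y with y ≟ v | y ≟ x
    ... | yes refl | _        = first , start
    ... | no _     | yes refl = last , finish
    ... | no y≢v   | no y≢x
      with j , t , _ ← proj₂ (proj₂ (proj₂ E₁)) v y (adjacent-to-v y≢v y≢x)
      = j , spoke y≢v y≢x t

    slot-touches : ∀ {y j} → Slot y j → Touches c₂ j x
    slot-touches start         = inj₁ (proj₁ (proj₂ E₂))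
    slot-touches finish        = inj₂ (proj₁ (proj₂ (proj₂ E₂)))
    slot-touches (spoke _ _ t) = spoke-touches t

    slot-injective : ∀ {y y′ j} → Slot y j → Slot y′ j → y ≡ y′
    slot-injective start           start            = refl
    slot-injective finish          finish           = refl
    slot-injective start           (spoke _ y′≢x t) = ⊥-elim (spoke-not-first y′≢x t)
    slot-injective finish          (spoke _ y′≢x t) = ⊥-elim (spoke-not-last y′≢x t)
    slot-injective (spoke _ y≢x t) start            = ⊥-elim (spoke-not-first y≢x t)
    slot-injective (spoke _ y≢x t) finish           = ⊥-elim (spoke-not-last y≢x t)
    slot-injective (spoke y≢v _ t) (spoke _ _ t′)   = traverses-functional c₁ t t′ y≢v

    x-neighbour : Fin n → Fin n
    x-neighbour y = proj₁ (touches⇒traverses c₂ (slot-touches (proj₂ (slot y))))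

    traverses-x-neighbour : ∀ y → Traverses c₂ (proj₁ (slot y)) x (x-neighbour y)
    traverses-x-neighbour y = proj₂ (touches⇒traverses c₂ (slot-touches (proj₂ (slot y))))

    x-neighbour-injective : Injective _≡_ _≡_ x-neighbour
    x-neighbour-injective {y} {y′} e =
      slot-injective (proj₂ (slot y)) (subst (Slot y′) (≡.sym same-step) (proj₂ (slot y′)))
      where
      same-step : proj₁ (slot y) ≡ proj₁ (slot y′)
      same-step = circuit-traverses-once c₂ G E₂ (traverses-x-neighbour y)
                    (subst (Traverses c₂ _ x) (≡.sym e) (traverses-x-neighbour y′))

    x-neighbour≢v : ∀ y → x-neighbour y ≢ v
    x-neighbour≢v y e =
      v≁x (adj-sym G (subst (Adj G x) e (traverses⇒adj c₂ G (proj₁ E₂) (traverses-x-neighbour y))))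

  no-avoiding-circuits-at-sole-non-neighbour : ⊥
  no-avoiding-circuits-at-sole-non-neighbour = injective⇒¬avoids x-neighbour-injective v x-neighbour≢v

lemma2 : (n : ℕ) → 4 ≤ n → 2 ∣ n → (G : Graph n) →
    ¬ (DoublyEulerian G × Σ (Fin n) λ v → degree G v ≡ n ∸ 2)
lemma2 n 4≤n _ G ((_ , doubly) , v , deg)
  with x , x≢v , v≁x , only-x ← sole-non-neighbour G v (≤-trans (s≤s (s≤s z≤n)) 4≤n) deg
  with y , v~y ← has-neighbour G (subst (1 ≤_) (≡.sym deg) (≤-trans (s≤s z≤n) (∸-monoˡ-≤ 2 4≤n)))
  with k , c₁ , c₂ , E₁ , E₂ , avoiding ← doubly x
  with circuit-length≥2 G c₁ E₁ v~y
... | s≤s (s≤s _) = no-avoiding-circuits-at-sole-non-neighbour G x≢v v≁x only-x E₁ E₂ avoiding
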